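{- Let $n\ge 5$ and let $\sigma$ be a maximal simplex of $\Delta_n=\mathcal{VR}(\mathbb{I}_n;3)$ that covers all places. If there is $w\in\sigma$ and a vertex $v$ such that $N(w)\cap\sigma=\{v\}$, then $N(v)\subseteq\sigma$.
   Context: $\mathbb{I}_n$ is the graph on $\{0,1\}^n$, two strings adjacent iff they differ in exactly one coordinate; distance is the number of differing coordinates. $\Delta_n=\mathcal{VR}(\mathbb{I}_n;3)$ is the simplicial complex whose simplices are the sets of vertices with pairwise distance at most $3$. For a vertex $v$, $v(i)$ is its $i$-th coordinate, $v^{i}$ is $v$ with coordinate $i$ flipped, and $N(v)=\{v^i:i\in[n]\}$. A simplex $\sigma$ covers all places if for each $i\in[n]$ there are $v,w\in\sigma$ with $v(i)=1$ and $w(i)=0$. -}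

module Defs where

open import Data.Bool using (Bool; true; false; not; _xor_)
open import Data.Nat using (ℕ; zero; suc; _≤_)
open import Data.Fin using (Fin)
open import Data.Vec using (Vec; []; _∷_; lookup; updateAt)
open import Data.Product using (Σ; ∃; _×_; _,_)
open import Relation.Binary.PropositionalEquality using (_≡_)

-- Vertices of the hypercube graph 𝕀ₙ: binary strings of length n.
Vertex : ℕ → Set
Vertex n = Vec Bool n

-- Hamming distance = number of coordinates in which two strings differ
-- (= graph distance in 𝕀ₙ).
dist : ∀ {n} → Vertex n → Vertex n → ℕ
dist [] [] = 0
dist (true ∷ xs) (false ∷ ys) = suc (dist xs ys)
dist (false ∷ xs) (true ∷ ys) = suc (dist xs ys)
dist (true ∷ xs) (true ∷ ys) = dist xs ys
dist (false ∷ xs) (false ∷ ys) = dist xs ys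

flipAt : ∀ {n} → Fin n → Vertex n → Vertex n
flipAt i v = updateAt v i not

-- A (finite, since the vertex set is finite) set of vertices, given by its
-- characteristic function.
VSet : ℕ → Set
VSet n = Vertex n → Bool

_∈ˢ_ : ∀ {n} → Vertex n → VSet n → Set
v ∈ˢ σ = σ v ≡ true

_⊆ˢ_ : ∀ {n} → VSet n → VSet n → Set
σ ⊆ˢ τ = ∀ v → v ∈ˢ σ → v ∈ˢ τ

IsSimplex : ∀ {n} → VSet n → Set
IsSimplex {n} σ =
  (∃ λ (v : Vertex n) → v ∈ˢ σ) ×
  (∀ v w → v ∈ˢ σ → w ∈ˢ σ → dist v w ≤ 3)

IsMaximalSimplex : ∀ {n} → VSet n → Set
IsMaximalSimplex σ = IsSimplex σ × (∀ τ → IsSimplex τ → σ ⊆ˢ τ → τ ⊆ˢ σ)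

CoversAllPlaces : ∀ {n} → VSet n → Set
CoversAllPlaces {n} σ =
  ∀ (i : Fin n) → ∃ λ (v : Vertex n) → ∃ λ (w : Vertex n) →
    v ∈ˢ σ × w ∈ˢ σ × lookup v i ≡ true × lookup w i ≡ false

_∈N_ : ∀ {n} → Vertex n → Vertex n → Set
u ∈N w = ∃ λ i → u ≡ flipAt i w

NeighbourhoodMeetsIn : ∀ {n} → Vertex n → VSet n → Vertex n → Set
NeighbourhoodMeetsIn w σ v =
  (v ∈N w × v ∈ˢ σ) × (∀ u → u ∈N w → u ∈ˢ σ → u ≡ v)

NeighbourhoodIn : ∀ {n} → Vertex n → VSet n → Set
NeighbourhoodIn v σ = ∀ u → u ∈N v → u ∈ˢ σ

module Submission where

-- Write u = vʲ for a neighbour of v = wⁱ; by maximality it suffices that every y ∈ σ is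
-- within 3 of u.  A y ∈ σ beyond 3 of u = w^{ji} agrees with w at i and has distance 2
-- from w, so y = w^{ab} with a, b, i distinct.  As wᵃ, wᵇ ∉ σ (v is the only neighbour of
-- w in σ), maximality yields vertices of σ beyond 3 of wᵃ and of wᵇ; being within 3 of
-- w, v and w^{ab}, they are w^{bic} and w^{aic} for one c.  Since σ covers all places and
-- n ≥ 5, some z ∈ σ differs from w at a fifth coordinate e, and no such z is within 3 of
-- all of w, v, w^{ab}, w^{bic}, w^{aic}.
--
-- Each step only involves the few coordinates K named so far: the distance from y to a
-- flip of w along K is the Hamming distance of the bit patterns on K plus the distance
-- of y off K, so every step is a finite check over patterns, decided by evaluation.

open import Defs
open import Data.Bool using (Bool; true; false; not; _xor_)
import Data.Bool.Properties as Bool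
open import Data.Empty using (⊥; ⊥-elim)
open import Data.Fin using (Fin; zero; suc)
import Data.Fin.Properties as Fin
open import Data.List using (List; []; _∷_)
open import Data.List.Relation.Unary.All as ListAll using ([]; _∷_)
open import Data.Nat using (ℕ; zero; suc; _+_; _≤_; _<_; _≤?_; s≤s; z≤n)
open import Data.Nat.Properties using (+-suc; suc-injective; m+n≤o⇒n≤o; allUpTo?) renaming (_≟_ to _≟ℕ_)
open import Data.Product using (∃; _×_; _,_; proj₁; proj₂)
open import Data.Sum using (_⊎_; inj₁; inj₂)
open import Data.Vec using (Vec; []; _∷_; lookup; map; head)
import Data.Vec.Properties as Vec
open import Data.Vec.Relation.Unary.All as VecAll using (All; []; _∷_)
open import Data.Vec.Relation.Unary.Unique.Propositional using (Unique)
open import Data.Vec.Relation.Unary.AllPairs using ([]; _∷_)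
open import Function using (_∘_)
open import Relation.Binary.PropositionalEquality
open import Relation.Nullary using (¬_; Dec; yes; no; ¬?; _×-dec_; _→-dec_; decidable-stable; contradiction)
open import Relation.Nullary.Decidable using (map′; True; toWitness)

private
  variable
    n m : ℕ

dist-refl : (v : Vertex n) → dist v v ≡ 0
dist-refl [] = refl
dist-refl (true ∷ v) = dist-refl v
dist-refl (false ∷ v) = dist-refl v

dist-sym : (v u : Vertex n) → dist v u ≡ dist u v
dist-sym [] [] = refl
dist-sym (true ∷ v) (true ∷ u) = dist-sym v u
dist-sym (true ∷ v) (false ∷ u) = cong suc (dist-sym v u)
dist-sym (false ∷ v) (true ∷ u) = cong suc (dist-sym v u)
dist-sym (false ∷ v) (false ∷ u) = dist-sym v u

dist≡0⇒≡ : (v u : Vertex n) → dist v u ≡ 0 → v ≡ u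
dist≡0⇒≡ [] [] _ = refl
dist≡0⇒≡ (true ∷ v) (true ∷ u) d = cong (true ∷_) (dist≡0⇒≡ v u d)
dist≡0⇒≡ (false ∷ v) (false ∷ u) d = cong (false ∷_) (dist≡0⇒≡ v u d)

dist≡suc⇒differ : ∀ {r} (v u : Vertex n) → dist v u ≡ suc r →
                  ∃ λ c → lookup v c xor lookup u c ≡ true
dist≡suc⇒differ [] [] ()
dist≡suc⇒differ (true ∷ v) (false ∷ u) _ = zero , refl
dist≡suc⇒differ (false ∷ v) (true ∷ u) _ = zero , refl
dist≡suc⇒differ (true ∷ v) (true ∷ u) d =
  let c , differ = dist≡suc⇒differ v u d in suc c , differ
dist≡suc⇒differ (false ∷ v) (false ∷ u) d =
  let c , differ = dist≡suc⇒differ v u d in suc c , differ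

dist-flipAt-agree : ∀ k (y s : Vertex n) → lookup y k xor lookup s k ≡ false →
                    dist y (flipAt k s) ≡ suc (dist y s)
dist-flipAt-agree zero (true ∷ y) (true ∷ s) _ = refl
dist-flipAt-agree zero (false ∷ y) (false ∷ s) _ = refl
dist-flipAt-agree (suc k) (true ∷ y) (true ∷ s) e = dist-flipAt-agree k y s e
dist-flipAt-agree (suc k) (true ∷ y) (false ∷ s) e = cong suc (dist-flipAt-agree k y s e)
dist-flipAt-agree (suc k) (false ∷ y) (true ∷ s) e = cong suc (dist-flipAt-agree k y s e)
dist-flipAt-agree (suc k) (false ∷ y) (false ∷ s) e = dist-flipAt-agree k y s e

dist-flipAt-differ : ∀ k (y s : Vertex n) → lookup y k xor lookup s k ≡ true →
                     dist y s ≡ suc (dist y (flipAt k s))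
dist-flipAt-differ zero (true ∷ y) (false ∷ s) _ = refl
dist-flipAt-differ zero (false ∷ y) (true ∷ s) _ = refl
dist-flipAt-differ (suc k) (true ∷ y) (true ∷ s) e = dist-flipAt-differ k y s e
dist-flipAt-differ (suc k) (true ∷ y) (false ∷ s) e = cong suc (dist-flipAt-differ k y s e)
dist-flipAt-differ (suc k) (false ∷ y) (true ∷ s) e = cong suc (dist-flipAt-differ k y s e)
dist-flipAt-differ (suc k) (false ∷ y) (false ∷ s) e = dist-flipAt-differ k y s e

flipAt-involutive : ∀ k (v : Vertex n) → flipAt k (flipAt k v) ≡ v
flipAt-involutive k v = begin
  updateAt (updateAt v k not) k not ≡⟨ Vec.updateAt-updateAt k v ⟩
  updateAt v k (not ∘ not)          ≡⟨ Vec.updateAt-cong k Bool.not-involutive v ⟩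
  updateAt v k (λ b → b)            ≡⟨ Vec.updateAt-id k v ⟩
  v                                 ∎
  where open ≡-Reasoning
        open Data.Vec using (updateAt)

flipIf : Bool → Fin n → Vertex n → Vertex n
flipIf true k v = flipAt k v
flipIf false k v = v

lookup-flipIf : ∀ b k (v : Vertex n) → lookup (flipIf b k v) k ≡ b xor lookup v k
lookup-flipIf true k v = Vec.lookup∘updateAt k v
lookup-flipIf false k v = refl

lookup-flipIf-≢ : ∀ b {c k} (v : Vertex n) → c ≢ k → lookup (flipIf b k v) c ≡ lookup v c
lookup-flipIf-≢ true {c} {k} v c≢k = Vec.lookup∘updateAt′ c k c≢k v
lookup-flipIf-≢ false v c≢k = refl

flipWhere : Vec (Fin n) m → Vec Bool m → Vertex n → Vertex n
flipWhere [] [] w = w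
flipWhere (k ∷ K) (b ∷ P) w = flipIf b k (flipWhere K P w)

patternOn : Vec (Fin n) m → Vertex n → Vertex n → Vec Bool m
patternOn K y w = map (λ k → lookup y k xor lookup w k) K

distOff : Vec (Fin n) m → Vertex n → Vertex n → ℕ
distOff K y w = dist y (flipWhere K (patternOn K y w) w)

lookup-flipWhere-∉ : ∀ {c} (K : Vec (Fin n) m) → All (c ≢_) K → ∀ P w →
                     lookup (flipWhere K P w) c ≡ lookup w c
lookup-flipWhere-∉ [] [] [] w = refl
lookup-flipWhere-∉ (k ∷ K) (c≢k ∷ c∉K) (b ∷ P) w =
  trans (lookup-flipIf-≢ b (flipWhere K P w) c≢k) (lookup-flipWhere-∉ K c∉K P w)

dist-flipIf-step : ∀ k (y s t : Vertex n) q b (Q P : Vec Bool m) →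
  lookup y k xor lookup t k ≡ q → lookup s k ≡ lookup t k →
  dist y s ≡ dist Q P + dist y t →
  dist y (flipIf b k s) ≡ dist (q ∷ Q) (b ∷ P) + dist y (flipIf q k t)
dist-flipIf-step k y s t false false Q P _ _ split = split
dist-flipIf-step k y s t false true Q P yt s≡t split =
  trans (dist-flipAt-agree k y s (trans (cong (lookup y k xor_) s≡t) yt)) (cong suc split)
dist-flipIf-step k y s t true false Q P yt _ split = begin
  dist y s                               ≡⟨ split ⟩
  dist Q P + dist y t                    ≡⟨ cong (dist Q P +_) (dist-flipAt-differ k y t yt) ⟩
  dist Q P + suc (dist y (flipAt k t))   ≡⟨ +-suc (dist Q P) _ ⟩
  suc (dist Q P + dist y (flipAt k t))   ∎
  where open ≡-Reasoning
dist-flipIf-step k y s t true true Q P yt s≡t split = suc-injective (begin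
  suc (dist y (flipAt k s))              ≡⟨ dist-flipAt-differ k y s (trans (cong (lookup y k xor_) s≡t) yt) ⟨
  dist y s                               ≡⟨ split ⟩
  dist Q P + dist y t                    ≡⟨ cong (dist Q P +_) (dist-flipAt-differ k y t yt) ⟩
  dist Q P + suc (dist y (flipAt k t))   ≡⟨ +-suc (dist Q P) _ ⟩
  suc (dist Q P + dist y (flipAt k t))   ∎)
  where open ≡-Reasoning

dist-flipWhere : (K : Vec (Fin n) m) → Unique K → ∀ y w P →
                 dist y (flipWhere K P w) ≡ dist (patternOn K y w) P + distOff K y w
dist-flipWhere [] [] y w [] = refl
dist-flipWhere (k ∷ K) (k∉K ∷ K-unique) y w (b ∷ P) =
  dist-flipIf-step k y s t _ b (patternOn K y w) P
    (cong (lookup y k xor_) (lookup-flipWhere-∉ K k∉K (patternOn K y w) w))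
    (trans (lookup-flipWhere-∉ K k∉K P w) (sym (lookup-flipWhere-∉ K k∉K (patternOn K y w) w)))
    (dist-flipWhere K K-unique y w P)
  where
  s = flipWhere K P w
  t = flipWhere K (patternOn K y w) w

xor-cancelʳ : ∀ a b → (a xor b) xor b ≡ a
xor-cancelʳ true true = refl
xor-cancelʳ true false = refl
xor-cancelʳ false true = refl
xor-cancelʳ false false = refl

fresh-if-differs : (K : Vec (Fin n) m) → Unique K → ∀ {c} y w →
  lookup y c xor lookup (flipWhere K (patternOn K y w) w) c ≡ true → All (c ≢_) K
fresh-if-differs [] [] y w _ = []
fresh-if-differs (k ∷ K) (k∉K ∷ K-unique) {c} y w differ = c≢k ∷ fresh-if-differs K K-unique y w
  (trans (cong (lookup y c xor_) (sym (lookup-flipIf-≢ q t c≢k))) differ)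
  where
  q = lookup y k xor lookup w k
  t = flipWhere K (patternOn K y w) w
  c≢k : c ≢ k
  c≢k refl = contradiction (begin
    false                                 ≡⟨ Bool.xor-same (lookup y k) ⟨
    lookup y k xor lookup y k             ≡⟨ cong (lookup y k xor_) (xor-cancelʳ (lookup y k) (lookup w k)) ⟨
    lookup y k xor (q xor lookup w k)     ≡⟨ cong (λ b → lookup y k xor (q xor b)) (lookup-flipWhere-∉ K k∉K (patternOn K y w) w) ⟨
    lookup y k xor (q xor lookup t k)     ≡⟨ cong (lookup y k xor_) (lookup-flipIf q k t) ⟨
    lookup y k xor lookup (flipIf q k t) k ≡⟨ differ ⟩
    true                                  ∎) λ ()
    where open ≡-Reasoning

Pinned : Vec Bool m → ℕ → Vec Bool m → ℕ → Set
Pinned Q r D s = D ≡ Q × s ≡ r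

Located : Vec (Fin n) m → Vertex n → Vertex n → Vec Bool m → ℕ → Set
Located K y w Q r = Pinned Q r (patternOn K y w) (distOff K y w)

located-exact : ∀ (K : Vec (Fin n) m) y w {Q} → Located K y w Q 0 → y ≡ flipWhere K Q w
located-exact K y w (refl , d) = dist≡0⇒≡ y _ d

located-tail : ∀ {k} (K : Vec (Fin n) m) y w {Q r} →
               Located (k ∷ K) y w (false ∷ Q) r → Located K y w Q r
located-tail {k = k} K y w (pattern-eq , d) with Vec.∷-injective pattern-eq
... | q≡false , refl =
  refl , trans (cong (λ b → dist y (flipIf b k (flipWhere K (patternOn K y w) w))) (sym q≡false)) d

located-extend : (K : Vec (Fin n) m) → Unique K → ∀ y w {Q r} → Located K y w Q (suc r) →
                 ∃ λ c → All (c ≢_) K × Located (c ∷ K) y w (true ∷ Q) r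
located-extend K K-unique y w {r = r} (refl , d) = c , c∉K , cong (_∷ _) q≡true , (begin
  dist y (flipIf q c t)     ≡⟨ cong (λ b → dist y (flipIf b c t)) q≡true ⟩
  dist y (flipAt c t)       ≡⟨ suc-injective (trans (sym (dist-flipAt-differ c y t differ)) d) ⟩
  r                         ∎)
  where
  open ≡-Reasoning
  t = flipWhere K (patternOn K y w) w
  c = proj₁ (dist≡suc⇒differ y t d)
  differ = proj₂ (dist≡suc⇒differ y t d)
  c∉K = fresh-if-differs K K-unique y w differ
  q = lookup y c xor lookup w c
  q≡true : q ≡ true
  q≡true = trans (cong (lookup y c xor_) (sym (lookup-flipWhere-∉ K c∉K _ w))) differ

position-if-not-fresh : ∀ c (K : Vec (Fin n) m) → ¬ All (c ≢_) K → ∃ λ p → lookup K p ≡ c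
position-if-not-fresh c [] not-fresh = contradiction [] not-fresh
position-if-not-fresh c (k ∷ K) not-fresh with c Fin.≟ k
... | yes refl = zero , refl
... | no c≢k = let p , K[p]≡c = position-if-not-fresh c K (not-fresh ∘ (c≢k ∷_)) in suc p , K[p]≡c

lookup-not-surjective : m < n → (K : Vec (Fin n) m) → ¬ (∀ c → ∃ λ p → lookup K p ≡ c)
lookup-not-surjective m<n K onto
  with c , c′ , c<c′ , same-position ← Fin.pigeonhole m<n (proj₁ ∘ onto)
  = Fin.<⇒≢ c<c′ (begin
    c                        ≡⟨ proj₂ (onto c) ⟨
    lookup K (proj₁ (onto c))  ≡⟨ cong (lookup K) same-position ⟩
    lookup K (proj₁ (onto c′)) ≡⟨ proj₂ (onto c′) ⟩
    c′                       ∎)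
  where open ≡-Reasoning

fresh-coordinate : m < n → (K : Vec (Fin n) m) → ∃ λ c → All (c ≢_) K
fresh-coordinate m<n K with Fin.any? (λ c → VecAll.all? (λ k → ¬? (c Fin.≟ k)) K)
... | yes fresh = fresh
... | no no-fresh = contradiction
  (λ c → position-if-not-fresh c K (λ fresh → no-fresh (c , fresh))) (lookup-not-surjective m<n K)

∀-or-∃¬ : {P : Vec Bool m → Set} → (∀ D → Dec (P D)) → (∀ D → P D) ⊎ ∃ λ D → ¬ P D
∀-or-∃¬ {zero} P? with P? []
... | yes p = inj₁ λ { [] → p }
... | no ¬p = inj₂ ([] , ¬p)
∀-or-∃¬ {suc m} P? with ∀-or-∃¬ (P? ∘ (true ∷_)) | ∀-or-∃¬ (P? ∘ (false ∷_))
... | inj₂ (D , ¬p) | _ = inj₂ (true ∷ D , ¬p)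
... | inj₁ _ | inj₂ (D , ¬p) = inj₂ (false ∷ D , ¬p)
... | inj₁ p | inj₁ q = inj₁ λ { (true ∷ D) → p D ; (false ∷ D) → q D }

∀-pattern? : {P : Vec Bool m → Set} → (∀ D → Dec (P D)) → Dec (∀ D → P D)
∀-pattern? P? with ∀-or-∃¬ P?
... | inj₁ all = yes all
... | inj₂ (D , ¬p) = no λ all → ¬p (all D)

data Constraint (m : ℕ) : Set where
  within3 beyond3 : Vec Bool m → Constraint m

Holds : (Vec Bool m → ℕ) → Constraint m → Set
Holds d (within3 P) = d P ≤ 3
Holds d (beyond3 P) = ¬ d P ≤ 3

holds? : ∀ (d : Vec Bool m → ℕ) c → Dec (Holds d c)
holds? d (within3 P) = d P ≤? 3
holds? d (beyond3 P) = ¬? (d P ≤? 3)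

-- By dist-flipWhere, D and r stand for patternOn K y w and distOff K y w of a vertex y,
-- and a pattern P in a constraint for the vertex flipWhere K P w.
Forces : List (Constraint m) → (Vec Bool m → ℕ → Set) → Set
Forces cs C = ∀ D r → ListAll.All (Holds (λ P → dist D P + r)) cs → C D r

forces? : ∀ P cs {C : Vec Bool m → ℕ → Set} → (∀ D r → Dec (C D r)) → Dec (Forces (within3 P ∷ cs) C)
forces? P cs {C} C? = map′ unbounded (λ forces D {r} _ → forces D r)
  (∀-pattern? λ D → allUpTo? (λ r → ListAll.all? (holds? (λ P → dist D P + r)) (within3 P ∷ cs) →-dec C? D r) 4)
  where
  -- The leading within3 constraint forces r ≤ 3, so checking r < 4 suffices.
  unbounded : (∀ D {r} → r < 4 → ListAll.All (Holds (λ Q → dist D Q + r)) (within3 P ∷ cs) → C D r) →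
              Forces (within3 P ∷ cs) C
  unbounded bounded D r holds@(within ∷ _) = bounded D (s≤s (m+n≤o⇒n≤o (dist D P) within)) holds

decide-forces : ∀ {P cs} {C : Vec Bool m → ℕ → Set} (C? : ∀ D r → Dec (C D r)) →
                {True (forces? P cs C?)} → Forces (within3 P ∷ cs) C
decide-forces C? {yes!} = toWitness yes!

pinned? : ∀ (Q : Vec Bool m) r D s → Dec (Pinned Q r D s)
pinned? Q r D s = Vec.≡-dec Bool._≟_ D Q ×-dec s ≟ℕ r

holds-cong : {d d′ : Vec Bool m → ℕ} → (∀ P → d P ≡ d′ P) → ∀ {c} → Holds d c → Holds d′ c
holds-cong d≗d′ {within3 P} = subst (_≤ 3) (d≗d′ P)
holds-cong d≗d′ {beyond3 P} far = far ∘ subst (_≤ 3) (sym (d≗d′ P))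

forces-patternOn : (K : Vec (Fin n) m) → Unique K → ∀ y w {cs C} →
  ListAll.All (Holds (λ P → dist y (flipWhere K P w))) cs → Forces cs C →
  C (patternOn K y w) (distOff K y w)
forces-patternOn K K-unique y w holds forces =
  forces _ _ (ListAll.map (holds-cong (dist-flipWhere K K-unique y w)) holds)

insert : Vertex n → VSet n → VSet n
insert u σ y with Vec.≡-dec Bool._≟_ y u
... | yes _ = true
... | no _ = σ y

module _ {u : Vertex n} {σ : VSet n} where

  ∈-insert-self : u ∈ˢ insert u σ
  ∈-insert-self with Vec.≡-dec Bool._≟_ u u
  ... | yes _ = refl
  ... | no u≢u = contradiction refl u≢u

  ⊆-insert : σ ⊆ˢ insert u σ
  ⊆-insert y y∈σ with Vec.≡-dec Bool._≟_ y u
  ... | yes _ = refl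
  ... | no _ = y∈σ

  ∈-insert⁻ : ∀ y → y ∈ˢ insert u σ → y ≡ u ⊎ y ∈ˢ σ
  ∈-insert⁻ y y∈ with Vec.≡-dec Bool._≟_ y u
  ... | yes y≡u = inj₁ y≡u
  ... | no _ = inj₂ y∈

module _ {σ : VSet n} (maximal : IsMaximalSimplex σ) where

  private
    σ-simplex = proj₁ maximal

  ∈-if-within3-of-all : ∀ u → (∀ y → y ∈ˢ σ → dist y u ≤ 3) → u ∈ˢ σ
  ∈-if-within3-of-all u near-all =
    proj₂ maximal (insert u σ) (nonempty , pairwise) ⊆-insert u (∈-insert-self {u = u} {σ})
    where
    nonempty : ∃ λ y → y ∈ˢ insert u σ
    nonempty = let y , y∈σ = proj₁ σ-simplex in y , ⊆-insert y y∈σ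
    pairwise : ∀ y z → y ∈ˢ insert u σ → z ∈ˢ insert u σ → dist y z ≤ 3
    pairwise y z y∈ z∈ with ∈-insert⁻ y y∈ | ∈-insert⁻ z z∈
    ... | inj₁ refl | inj₁ refl = subst (_≤ 3) (sym (dist-refl y)) z≤n
    ... | inj₁ refl | inj₂ z∈σ = subst (_≤ 3) (dist-sym z y) (near-all z z∈σ)
    ... | inj₂ y∈σ | inj₁ refl = near-all y y∈σ
    ... | inj₂ y∈σ | inj₂ z∈σ = proj₂ σ-simplex y z y∈σ z∈σ

  far-member-if-∉ : ∀ u → ¬ u ∈ˢ σ → ∃ λ y → y ∈ˢ σ × ¬ dist y u ≤ 3
  far-member-if-∉ u u∉σ with ∀-or-∃¬ (λ y → (σ y Bool.≟ true) →-dec (dist y u ≤? 3))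
  ... | inj₁ near-all = contradiction (∈-if-within3-of-all u near-all) u∉σ
  ... | inj₂ (y , ¬near) =
    y , decidable-stable (σ y Bool.≟ true) (λ y∉σ → ¬near (⊥-elim ∘ y∉σ)) , ¬near ∘ (λ near _ → near)

member-differing-at : {σ : VSet n} → CoversAllPlaces σ → ∀ w e →
                      ∃ λ z → z ∈ˢ σ × lookup z e xor lookup w e ≡ true
member-differing-at covers w e with covers e | lookup w e
... | p , _ , p∈σ , _ , p[e]≡true , _ | false = p , p∈σ , cong (_xor false) p[e]≡true
... | _ , q , _ , q∈σ , _ , q[e]≡false | true = q , q∈σ , cong (_xor true) q[e]≡false

module Configuration
  {σ : VSet n} (maximal : IsMaximalSimplex σ)
  {w : Vertex n} (w∈σ : w ∈ˢ σ) {i : Fin n} (v∈σ : flipAt i w ∈ˢ σ)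
  (only-neighbour : ∀ u → u ∈N w → u ∈ˢ σ → u ≡ flipAt i w)
  where

  -- v = wⁱ, and w^{ab…} is w with the coordinates a, b, … flipped.
  near : ∀ {y z} → y ∈ˢ σ → z ∈ˢ σ → dist y z ≤ 3
  near {y} {z} = proj₂ (proj₁ maximal) y z

  flipAt-∉ : ∀ {a} → a ≢ i → ¬ flipAt a w ∈ˢ σ
  flipAt-∉ {a} a≢i wᵃ∈σ = Bool.not-¬ refl (begin
    lookup w a                   ≡⟨ Vec.lookup∘updateAt′ a i a≢i w ⟨
    lookup (flipAt i w) a        ≡⟨ cong (λ u → lookup u a) (only-neighbour _ (a , refl) wᵃ∈σ) ⟨
    lookup (flipAt a w) a        ≡⟨ Vec.lookup∘updateAt a w ⟩
    not (lookup w a)             ∎)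
    where open ≡-Reasoning

  located-member : ∀ (K : Vec (Fin n) m) y {Q} → y ∈ˢ σ → Located K y w Q 0 → flipWhere K Q w ∈ˢ σ
  located-member K y y∈σ loc = subst (_∈ˢ σ) (located-exact K y w loc) y∈σ

  distance-two-member-is-wᵃᵇ : ∀ {x} → x ∈ˢ σ → Located (i ∷ []) x w (false ∷ []) 2 →
    ∃ λ a → ∃ λ b → Unique (b ∷ a ∷ i ∷ []) × flipAt b (flipAt a w) ∈ˢ σ
  distance-two-member-is-wᵃᵇ {x} x∈σ x-loc
    with a , a∉ , x-loc₁ ← located-extend (i ∷ []) ([] ∷ []) x w x-loc
    with b , b∉ , x-loc₂ ← located-extend (a ∷ i ∷ []) (a∉ ∷ [] ∷ []) x w x-loc₁
    = a , b , b∉ ∷ a∉ ∷ [] ∷ [] , located-member (b ∷ a ∷ i ∷ []) x x∈σ x-loc₂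

  far-from-wᵃ-is-wᵇⁱᶜ : ∀ {a b} → Unique (b ∷ a ∷ i ∷ []) → flipAt b (flipAt a w) ∈ˢ σ →
    ∃ λ c → Unique (c ∷ b ∷ a ∷ i ∷ []) × flipAt c (flipAt b (flipAt i w)) ∈ˢ σ
  far-from-wᵃ-is-wᵇⁱᶜ {a} {b} K-unique@(_ ∷ (a≢i ∷ []) ∷ _) x∈σ =
    let y , y∈σ , y-far = far-member-if-∉ maximal (flipAt a w) (flipAt-∉ a≢i)
        c , c∉ , y-loc = located-extend K K-unique y w
          (forces-patternOn K K-unique y w (near y∈σ w∈σ ∷ near y∈σ v∈σ ∷ near y∈σ x∈σ ∷ y-far ∷ []) pins)
    in c , c∉ ∷ K-unique , located-member (c ∷ K) y y∈σ y-loc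
    where
    K = b ∷ a ∷ i ∷ []
    pins : Forces (within3 (false ∷ false ∷ false ∷ []) ∷ within3 (false ∷ false ∷ true ∷ [])
                   ∷ within3 (true ∷ true ∷ false ∷ []) ∷ beyond3 (false ∷ true ∷ false ∷ []) ∷ [])
                  (Pinned (true ∷ false ∷ true ∷ []) 1)
    pins = decide-forces (pinned? _ _)

  far-from-wᵇ-is-wᵃⁱᶜ : ∀ {a b c} → Unique (c ∷ b ∷ a ∷ i ∷ []) →
    flipAt b (flipAt a w) ∈ˢ σ → flipAt c (flipAt b (flipAt i w)) ∈ˢ σ →
    flipAt c (flipAt a (flipAt i w)) ∈ˢ σ
  far-from-wᵇ-is-wᵃⁱᶜ {a} {b} {c} K-unique@(_ ∷ (_ ∷ b≢i ∷ []) ∷ _) x∈σ y₁∈σ =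
    let y , y∈σ , y-far = far-member-if-∉ maximal (flipAt b w) (flipAt-∉ b≢i)
        y-loc = forces-patternOn K K-unique y w
          (near y∈σ w∈σ ∷ near y∈σ v∈σ ∷ near y∈σ x∈σ ∷ near y∈σ y₁∈σ ∷ y-far ∷ []) pins
    in located-member K y y∈σ y-loc
    where
    K = c ∷ b ∷ a ∷ i ∷ []
    pins : Forces (within3 (false ∷ false ∷ false ∷ false ∷ []) ∷ within3 (false ∷ false ∷ false ∷ true ∷ [])
                   ∷ within3 (false ∷ true ∷ true ∷ false ∷ []) ∷ within3 (true ∷ true ∷ false ∷ true ∷ [])
                   ∷ beyond3 (false ∷ true ∷ false ∷ false ∷ []) ∷ [])
                  (Pinned (true ∷ false ∷ true ∷ true ∷ []) 0)
    pins = decide-forces (pinned? _ _)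

  no-fifth-coordinate : 5 ≤ n → CoversAllPlaces σ → ∀ {a b c} → Unique (c ∷ b ∷ a ∷ i ∷ []) →
    flipAt b (flipAt a w) ∈ˢ σ → flipAt c (flipAt b (flipAt i w)) ∈ˢ σ →
    flipAt c (flipAt a (flipAt i w)) ∈ˢ σ → ⊥
  no-fifth-coordinate 5≤n covers {a} {b} {c} K-unique x∈σ y₁∈σ y₂∈σ =
    let e , e∉ = fresh-coordinate 5≤n K
        z , z∈σ , z-differs = member-differing-at covers w e
        z-agrees = forces-patternOn (e ∷ K) (e∉ ∷ K-unique) z w
          (near z∈σ w∈σ ∷ near z∈σ v∈σ ∷ near z∈σ x∈σ ∷ near z∈σ y₁∈σ ∷ near z∈σ y₂∈σ ∷ []) agrees
    in contradiction (trans (sym z-differs) z-agrees) λ ()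
    where
    K = c ∷ b ∷ a ∷ i ∷ []
    agrees : Forces (within3 (false ∷ false ∷ false ∷ false ∷ false ∷ [])
                     ∷ within3 (false ∷ false ∷ false ∷ false ∷ true ∷ [])
                     ∷ within3 (false ∷ false ∷ true ∷ true ∷ false ∷ [])
                     ∷ within3 (false ∷ true ∷ true ∷ false ∷ true ∷ [])
                     ∷ within3 (false ∷ true ∷ false ∷ true ∷ true ∷ []) ∷ [])
                    (λ D _ → head D ≡ false)
    agrees = decide-forces (λ D _ → head D Bool.≟ false)

  no-member-at-distance-two : 5 ≤ n → CoversAllPlaces σ → ∀ {x} → x ∈ˢ σ →
    Located (i ∷ []) x w (false ∷ []) 2 → ⊥
  no-member-at-distance-two 5≤n covers x∈σ x-loc =
    let a , b , K₃-unique , x′∈σ = distance-two-member-is-wᵃᵇ x∈σ x-loc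
        c , K₄-unique , y₁∈σ = far-from-wᵃ-is-wᵇⁱᶜ K₃-unique x′∈σ
    in no-fifth-coordinate 5≤n covers K₄-unique x′∈σ y₁∈σ (far-from-wᵇ-is-wᵃⁱᶜ K₄-unique x′∈σ y₁∈σ)

  neighbour-of-v-within3 : 5 ≤ n → CoversAllPlaces σ → ∀ j y → y ∈ˢ σ →
                           dist y (flipAt j (flipAt i w)) ≤ 3
  neighbour-of-v-within3 5≤n covers j y y∈σ with j Fin.≟ i
  ... | yes refl = subst (λ u → dist y u ≤ 3) (sym (flipAt-involutive i w)) (near y∈σ w∈σ)
  ... | no j≢i = decidable-stable (dist y _ ≤? 3) λ y-far →
    no-member-at-distance-two 5≤n covers y∈σ (located-tail (i ∷ []) y w
      (forces-patternOn (j ∷ i ∷ []) ((j≢i ∷ []) ∷ [] ∷ []) y w (near y∈σ w∈σ ∷ near y∈σ v∈σ ∷ y-far ∷ []) pins))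
    where
    pins : Forces (within3 (false ∷ false ∷ []) ∷ within3 (false ∷ true ∷ []) ∷ beyond3 (true ∷ true ∷ []) ∷ [])
                  (Pinned (false ∷ false ∷ []) 2)
    pins = decide-forces (pinned? _ _)

lemma4p2 : (n : ℕ) → 5 ≤ n → (σ : VSet n) →
    IsMaximalSimplex σ → CoversAllPlaces σ →
    (w v : Vertex n) → w ∈ˢ σ → NeighbourhoodMeetsIn w σ v →
    NeighbourhoodIn v σ
lemma4p2 n 5≤n σ maximal covers w .(flipAt i w) w∈σ (((i , refl) , v∈σ) , only-neighbour) .(flipAt j (flipAt i w)) (j , refl) =
  ∈-if-within3-of-all maximal _
    (Configuration.neighbour-of-v-within3 maximal w∈σ v∈σ only-neighbour 5≤n covers j)
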